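{- Let $k,n\ge 1$, let $a_{ij}\in\mathbb{Z}$ for $1\le i\le k$, $1\le j\le n$, let $b_1,\dots,b_k\in\mathbb{Z}$, and let $m_1,\dots,m_k$ be pairwise coprime positive integers with $m=m_1\cdots m_k$. Consider the system of congruences \[ a_{i1}x_1+a_{i2}x_2+\dots+a_{in}x_n\equiv b_i \pmod{m_i},\qquad 1\le i\le k . \] For $1\le i\le k$ let $\ell_i=(a_{i1},\dots,a_{in},m_i)$. Then the system has a solution $(x_1,\dots,x_n)\in\mathbb{Z}_m^n$ if and only if $\ell_i\mid b_i$ for every $1\le i\le k$; and if this condition holds, the number of solutions $(x_1,\dots,x_n)\in\mathbb{Z}_m^n$ is $m^{n-1}\prod_{i=1}^k \ell_i$.
   Context: $(u_1,\dots,u_r)$ denotes the greatest common divisor of integers $u_1,\dots,u_r$; $\mathbb{Z}_m=\mathbb{Z}/m\mathbb{Z}$. -}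

module Defs where

open import Data.Nat as ℕ using (ℕ; zero; suc)
open import Data.Nat.GCD using (gcd)
open import Data.Nat.Divisibility as ℕD using ()
open import Data.Integer as ℤ using (ℤ; +_; ∣_∣; _-_)
open import Data.Integer.Divisibility using (_∣_)
open import Data.Fin using (Fin; zero; suc; toℕ)
open import Data.Vec using (Vec; []; _∷_; lookup)
open import Data.List using (List; []; _∷_; [_]; map; concatMap; filter; length)
open import Data.List as L using (allFin)
open import Relation.Nullary using (Dec)
open import Relation.Unary using (Decidable)

∑ℤ : ∀ {n} → (Fin n → ℤ) → ℤ
∑ℤ {zero}  f = + 0
∑ℤ {suc n} f = f zero ℤ.+ ∑ℤ (λ j → f (suc j))

∏ℕ : ∀ {k} → (Fin k → ℕ) → ℕ
∏ℕ {zero}  f = 1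
∏ℕ {suc k} f = f zero ℕ.* ∏ℕ (λ i → f (suc i))

gcdWith : ∀ {n} → (Fin n → ℤ) → ℕ → ℕ
gcdWith {zero}  u m = m
gcdWith {suc n} u m = gcd ∣ u zero ∣ (gcdWith (λ j → u (suc j)) m)

_≡_[mod_] : ℤ → ℤ → ℕ → Set
a ≡ b [mod m ] = (+ m) ∣ (a - b)

_≡?_[mod_] : (a b : ℤ) (m : ℕ) → Dec (a ≡ b [mod m ])
a ≡? b [mod m ] = m ℕD.∣? ∣ a - b ∣

-- canonical integer representative of an element of ℤ_m = Fin m
⟦_⟧ : ∀ {m} → Fin m → ℤ
⟦ x ⟧ = + toℕ x

Solves : ∀ {k n m} → (Fin k → Fin n → ℤ) → (Fin k → ℤ) → (Fin k → ℕ)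
       → Vec (Fin m) n → Set
Solves {k} a b ms x =
  (i : Fin k) → ∑ℤ (λ j → a i j ℤ.* ⟦ lookup x j ⟧) ≡ b i [mod ms i ]

solves? : ∀ {k n m} (a : Fin k → Fin n → ℤ) (b : Fin k → ℤ) (ms : Fin k → ℕ)
        → Decidable (Solves {k} {n} {m} a b ms)
solves? {zero}  a b ms x = Relation.Nullary.yes (λ ())
  where import Relation.Nullary
solves? {suc k} a b ms x with
  ∑ℤ (λ j → a zero j ℤ.* ⟦ lookup x j ⟧) ≡? b zero [mod ms zero ]
     | solves? {k} (λ i → a (suc i)) (λ i → b (suc i)) (λ i → ms (suc i)) x
... | Relation.Nullary.yes p | Relation.Nullary.yes q =
  Relation.Nullary.yes (λ { zero → p ; (suc i) → q i })
... | Relation.Nullary.no ¬p | _ = Relation.Nullary.no (λ s → ¬p (s zero))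
... | _ | Relation.Nullary.no ¬q = Relation.Nullary.no (λ s → ¬q (λ i → s (suc i)))

allVecs : (n m : ℕ) → List (Vec (Fin m) n)
allVecs zero    m = [ [] ]
allVecs (suc n) m = concatMap (λ c → map (c ∷_) (allVecs n m)) (allFin m)

#solutions : ∀ {k} (n m : ℕ) → (Fin k → Fin n → ℤ) → (Fin k → ℤ) → (Fin k → ℕ) → ℕ
#solutions n m a b ms = length (filter (solves? {m = m} a b ms) (allVecs n m))

module Submission where

-- Fix the first unknown x_1 = c ∈ [0, m). The rest is a system in n − 1 unknowns with
-- right-hand sides b_i − a_i1 c; by induction it is solvable iff ℓ′_i ∣ b_i − a_i1 c for all i,
-- where ℓ′_i = (a_i2, …, a_in, m_i), and then has m^(n−2) ∏ ℓ′_i solutions (read as 1 when n = 1).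
-- So the admissible c are the solutions of the congruences a_i1 c ≡ b_i (mod ℓ′_i), whose moduli
-- divide the m_i and are therefore pairwise coprime. As (a_i1, ℓ′_i) = ℓ_i ∣ b_i, the i-th
-- congruence defines one class modulo ℓ′_i / ℓ_i, and the Chinese remainder theorem glues these
-- into one class modulo ∏ ℓ′_i / ∏ ℓ_i, which meets [0, m) in m ∏ ℓ_i / ∏ ℓ′_i points. Summing
-- over c gives m^(n−1) ∏ ℓ_i solutions, in particular at least one. Conversely ℓ_i divides m_i
-- and every a_i1 x_1 + ⋯ + a_in x_n, hence b_i.

open import Defs
open import Data.Nat as ℕ using (ℕ; zero; suc; NonZero; _^_; _∸_; _≥_; _>_)
import Data.Nat.Properties as ℕ
import Data.Nat.Divisibility as ℕ
open import Data.Nat.GCD using (gcd; gcd-GCD; gcd[m,n]∣m; gcd[m,n]∣n; gcd[m,n]≡0⇒n≡0; module Bézout)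
open import Data.Nat.Coprimality as Coprimality using (Coprime; coprime⇒gcd≡1; coprime-divisor)
open import Data.Nat.ListAction using (sum)
import Algebra.Properties.CommutativeSemigroup ℕ.*-commutativeSemigroup as ℕ*
open import Data.Integer as ℤ using (ℤ; +_; -[1+_]; ∣_∣; 0ℤ; 1ℤ)
import Data.Integer.Properties as ℤ
open import Data.Integer.DivMod using (_%ℕ_; _/ℕ_; n%ℕd<d; a≡a%ℕn+[a/ℕn]*n)
open import Data.Integer.Divisibility using (_∣_)
import Data.Integer.Divisibility.Signed as Signed
open import Data.Integer.Tactic.RingSolver using (solve-∀)
open import Data.Fin using (Fin; zero; suc; toℕ)
import Data.Fin.Properties as Fin
open import Data.Vec using (Vec; []; _∷_; lookup)
open import Data.List using (List; []; _∷_; _++_; map; concatMap; filter; length; tabulate; allFin)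
import Data.List.Properties as List
import Data.List.Relation.Unary.All as All
open import Data.Product using (Σ; ∃₂; _×_; _,_; proj₁; proj₂)
open import Data.Product.Function.NonDependent.Propositional using (_×-⇔_)
open import Function.Base using (_∘_; id)
open import Function.Bundles using (_⇔_; mk⇔; Equivalence)
open import Function.Properties.Equivalence using (⇔-setoid)
open import Level using (0ℓ)
open import Relation.Binary.Bundles using (Setoid)
open import Relation.Binary.Structures using (IsEquivalence)
open import Relation.Binary.PropositionalEquality
  using (_≡_; _≢_; refl; sym; trans; cong; cong₂; subst; subst₂; module ≡-Reasoning)
import Relation.Binary.Reasoning.Setoid as SetoidReasoning
open import Relation.Nullary using (Dec; yes; no; ¬_; contradiction)
import Relation.Nullary.Decidable as Dec
open import Relation.Unary using (Pred; Decidable)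

-- Integer arithmetic is written unqualified in this module; outside it, _*_ is multiplication in ℕ.
module LinearCongruences where

  open import Data.Integer using (_+_; _*_; -_; _-_)

  module ⇔-Reasoning = SetoidReasoning (⇔-setoid 0ℓ)

  -- Congruences

  -- `a ≡ b [mod m ]` unfolds to a divisibility of `a - b`, from which Agda cannot recover
  -- `a` and `b`; congruences are therefore manipulated through this injective record.
  record Congruent (m : ℕ) (a b : ℤ) : Set where
    constructor congruent
    field holds : a ≡ b [mod m ]

  open Congruent public

  private
    toSigned : ∀ {m a b} → Congruent m a b → + m Signed.∣ (a - b)
    toSigned {m} {a} {b} (congruent h) = Signed.∣ᵤ⇒∣ {+ m} {a - b} h

    fromSigned : ∀ {m a b} → + m Signed.∣ (a - b) → Congruent m a b
    fromSigned {m} h = congruent (Signed.∣⇒∣ᵤ {+ m} h)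

  ≡-mod-isEquivalence : ∀ m → IsEquivalence (Congruent m)
  ≡-mod-isEquivalence m = record
    { refl  = λ {a} → fromSigned (subst (Signed._∣_ (+ m)) (sym (ℤ.+-inverseʳ a)) (Signed.∣ᵤ⇒∣ (ℕ._∣0 m)))
    ; sym   = λ {a} {b} (congruent h) → congruent (subst (m ℕ.∣_) (ℤ.∣i-j∣≡∣j-i∣ a b) h)
    ; trans = λ {a} {b} {c} p q →
        fromSigned (subst (Signed._∣_ (+ m)) (telescope a b c) (Signed.∣m∣n⇒∣m+n (toSigned p) (toSigned q)))
    }
    where telescope : ∀ a b c → (a - b) + (b - c) ≡ a - c
          telescope = solve-∀

  ≡-mod-setoid : ℕ → Setoid 0ℓ 0ℓ
  ≡-mod-setoid m = record { isEquivalence = ≡-mod-isEquivalence m }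

  module ≡-mod-Reasoning (m : ℕ) = SetoidReasoning (≡-mod-setoid m)

  module _ {m : ℕ} where
    open Setoid (≡-mod-setoid m) public using () renaming (sym to congruent-sym; trans to congruent-trans)

  congruent? : ∀ m a b → Dec (Congruent m a b)
  congruent? m a b = Dec.map′ congruent holds (a ≡? b [mod m ])

  congruent-∣ : ∀ {m n a b} → n ℕ.∣ m → Congruent m a b → Congruent n a b
  congruent-∣ n∣m (congruent h) = congruent (ℕ.∣-trans n∣m h)

  congruent-multiple : ∀ {m a b} (w : ℤ) → a - b ≡ w * + m → Congruent m a b
  congruent-multiple {m} w eq = fromSigned (subst (Signed._∣_ (+ m)) (sym eq) (Signed.∣n⇒∣m*n w Signed.∣-refl))

  congruent-*ˡ : ∀ {m a b} (c : ℤ) → Congruent m a b → Congruent m (c * a) (c * b)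
  congruent-*ˡ {m} {a} {b} c p =
    fromSigned (subst (Signed._∣_ (+ m)) (distrib c a b) (Signed.∣n⇒∣m*n c (toSigned p)))
    where distrib : ∀ c a b → c * (a - b) ≡ c * a - c * b
          distrib = solve-∀

  congruent-*-cancelʳ : ∀ {e g a b} .{{_ : NonZero g}} →
    Congruent (e ℕ.* g) (a * + g) (b * + g) ⇔ Congruent e a b
  congruent-*-cancelʳ {e} {g} {a} {b} = mk⇔
    (λ p → fromSigned (Signed.*-cancelʳ-∣ (+ g) (subst₂ Signed._∣_ (ℤ.pos-* e g) (factor a b (+ g)) (toSigned p))))
    (λ p → fromSigned (subst₂ Signed._∣_ (sym (ℤ.pos-* e g)) (sym (factor a b (+ g)))
                                (Signed.*-monoˡ-∣ (+ g) (toSigned p))))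
    where factor : ∀ a b g → a * g - b * g ≡ (a - b) * g
          factor = solve-∀

  congruent-invert : ∀ {e} {u v α β x : ℤ} → u * α + v * + e ≡ 1ℤ →
    Congruent e β (α * x) ⇔ Congruent e x (u * β)
  congruent-invert {e} {u} {v} {α} {β} {x} u*α+v*e≡1 = mk⇔
    (λ β≡αx → begin
      x                     ≡⟨ times-one x ⟩
      x * (u * α + v * + e) ≈⟨ congruent-multiple (x * v) (expand-x u α v (+ e) x) ⟩
      u * (α * x)           ≈⟨ congruent-*ˡ u β≡αx ⟨
      u * β                 ∎)
    (λ x≡uβ → begin
      β                     ≡⟨ times-one β ⟩
      β * (u * α + v * + e) ≈⟨ congruent-multiple (β * v) (expand-β u α v (+ e) β) ⟩
      α * (u * β)           ≈⟨ congruent-*ˡ α x≡uβ ⟨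
      α * x                 ∎)
    where
    open ≡-mod-Reasoning e
    times-one : ∀ y → y ≡ y * (u * α + v * + e)
    times-one y = sym (trans (cong (y *_) u*α+v*e≡1) (ℤ.*-identityʳ y))
    expand-x : ∀ u α v e x → x * (u * α + v * e) - u * (α * x) ≡ x * v * e
    expand-x = solve-∀
    expand-β : ∀ u α v e β → β * (u * α + v * e) - α * (u * β) ≡ β * v * e
    expand-β = solve-∀

  congruent-<⇒≡ : ∀ {m x y} → x ℕ.< m → y ℕ.< m → Congruent m (+ x) (+ y) → x ≡ y
  congruent-<⇒≡ {m} {x} {y} x<m y<m (congruent m∣x-y) =
    ℤ.+-injective (ℤ.i-j≡0⇒i≡j (+ x) (+ y) (ℤ.∣i∣≡0⇒i≡0 (small-multiple m∣x-y ∣x-y∣<m)))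
    where
    ∣x-y∣<m : ∣ + x - + y ∣ ℕ.< m
    ∣x-y∣<m = ℕ.≤-<-trans (subst (ℕ._≤ x ℕ.⊔ y) (cong ∣_∣ (sym (ℤ.m-n≡m⊖n x y)))
                                 (ℤ.∣m⊝n∣≤m⊔n x y))
                         (ℕ.⊔-pres-<m x<m y<m)
    small-multiple : ∀ {m n} → m ℕ.∣ n → n ℕ.< m → n ≡ 0
    small-multiple {n = zero}  _   _   = refl
    small-multiple {n = suc _} m∣n n<m = contradiction m∣n (ℕ.>⇒∤ n<m)

  -- Bézout's identity over ℤ

  private
    embed : ∀ g y d x p → g ℕ.+ y ℕ.* d ≡ x ℕ.* p → + g + + y * + d ≡ + x * + p
    embed g y d x p eq = begin
      + g + + y * + d     ≡⟨ cong (λ t → + g + t) (ℤ.pos-* y d) ⟨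
      + g + + (y ℕ.* d)   ≡⟨ ℤ.pos-+ g (y ℕ.* d) ⟨
      + (g ℕ.+ y ℕ.* d)   ≡⟨ cong +_ eq ⟩
      + (x ℕ.* p)         ≡⟨ ℤ.pos-* x p ⟩
      + x * + p           ∎
      where open ≡-Reasoning

  bézout : ∀ (α : ℤ) (d : ℕ) → ∃₂ λ u v → u * α + v * + d ≡ + gcd ∣ α ∣ d
  bézout (+ p) d with Bézout.identity (gcd-GCD p d)
  ... | Bézout.+- x y eq = + x , - + y ,
    trans (cong (_+ - + y * + d) (sym (embed (gcd p d) y d x p eq))) (cancel (+ gcd p d) (+ y) (+ d))
    where cancel : ∀ g y d → (g + y * d) + - y * d ≡ g
          cancel = solve-∀
  ... | Bézout.-+ x y eq = - + x , + y ,
    trans (cong (λ t → - + x * + p + t) (sym (embed (gcd p d) x p y d eq))) (cancel (+ gcd p d) (+ x) (+ p))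
    where cancel : ∀ g x p → - x * p + (g + x * p) ≡ g
          cancel = solve-∀
  bézout -[1+ p ] d with bézout (+ suc p) d
  ... | u , v , eq = - u , v , trans (cong (_+ v * + d) (neg-*-neg u (+ suc p))) eq
    where neg-*-neg : ∀ u a → - u * - a ≡ u * a
          neg-*-neg = solve-∀

  bézout-/gcd : ∀ {u v a e g} .{{_ : NonZero g}} → u * (a * + g) + v * (+ e * + g) ≡ + g → u * a + v * + e ≡ 1ℤ
  bézout-/gcd {u} {v} {a} {e} {g} eq = ℤ.*-cancelʳ-≡ _ _ (+ g) (begin
    (u * a + v * + e) * + g          ≡⟨ distribute u a v (+ e) (+ g) ⟩
    u * (a * + g) + v * (+ e * + g) ≡⟨ eq ⟩
    + g                              ≡⟨ ℤ.*-identityˡ (+ g) ⟨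
    1ℤ * + g                         ∎)
    where open ≡-Reasoning
          distribute : ∀ u a v e g → (u * a + v * e) * g ≡ u * (a * g) + v * (e * g)
          distribute = solve-∀

  record ResidueClass (P : ℤ → Set) (D G : ℕ) : Set where
    field
      modulus     : ℕ
      residue     : ℤ
      modulus*G≡D : modulus ℕ.* G ≡ D
      solutions   : ∀ x → P x ⇔ Congruent modulus x residue

  linear-congruence : ∀ (d : ℕ) .{{_ : NonZero d}} (α β : ℤ) → + (gcd ∣ α ∣ d) ∣ β →
    ResidueClass (λ x → Congruent d β (α * x)) d (gcd ∣ α ∣ d)
  linear-congruence d α β g∣β = record
    { modulus = e ; residue = u * β′ ; modulus*G≡D = sym d≡e*g ; solutions = λ x → begin
    Congruent d β (α * x)                          ≡⟨ cong₂ (λ D y → Congruent D β y) d≡e*g (α*x≡α′*x*g x) ⟩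
    Congruent (e ℕ.* g) β ((α′ * x) * + g)         ≡⟨ cong (λ b → Congruent (e ℕ.* g) b ((α′ * x) * + g)) β≡β′*g ⟩
    Congruent (e ℕ.* g) (β′ * + g) ((α′ * x) * + g) ≈⟨ congruent-*-cancelʳ ⟩
    Congruent e β′ (α′ * x)                        ≈⟨ congruent-invert {u = u} {v} {α′} u*α′+v*e≡1 ⟩
    Congruent e x (u * β′)                         ∎ }
    where
    open ⇔-Reasoning
    g = gcd ∣ α ∣ d
    instance
      g≢0 : NonZero g
      g≢0 = ℕ.≢-nonZero λ g≡0 → ℕ.≢-nonZero⁻¹ d (gcd[m,n]≡0⇒n≡0 ∣ α ∣ g≡0)
    open Signed._∣_ (Signed.∣ᵤ⇒∣ {+ g} {α} (gcd[m,n]∣m ∣ α ∣ d))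
      using () renaming (quotient to α′; equality to α≡α′*g)
    open Signed._∣_ (Signed.∣ᵤ⇒∣ {+ g} {β} g∣β)
      using () renaming (quotient to β′; equality to β≡β′*g)
    open ℕ._∣_ (gcd[m,n]∣n ∣ α ∣ d)
      using () renaming (quotient to e; equality to d≡e*g)
    α*x≡α′*x*g : ∀ x → α * x ≡ (α′ * x) * + g
    α*x≡α′*x*g x = trans (cong (_* x) α≡α′*g) (swap α′ (+ g) x)
      where swap : ∀ a g x → a * g * x ≡ a * x * g
            swap = solve-∀
    u = proj₁ (bézout α d)
    v = proj₁ (proj₂ (bézout α d))
    u*α′+v*e≡1 : u * α′ + v * + e ≡ 1ℤ
    u*α′+v*e≡1 = bézout-/gcd {u} {v} {α′} {e} {g}
      (subst₂ (λ s t → u * s + v * t ≡ + g) α≡α′*g (trans (cong +_ d≡e*g) (ℤ.pos-* e g)) (proj₂ (proj₂ (bézout α d))))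

  -- Coprime moduli and the Chinese remainder theorem

  coprime-∣ : ∀ {a b c d} → Coprime a b → c ℕ.∣ a → d ℕ.∣ b → Coprime c d
  coprime-∣ coprime c∣a d∣b (i∣c , i∣d) = coprime (ℕ.∣-trans i∣c c∣a , ℕ.∣-trans i∣d d∣b)

  coprime-*ʳ : ∀ {a b c} → Coprime a b → Coprime a c → Coprime a (b ℕ.* c)
  coprime-*ʳ a⊥b a⊥c (i∣a , i∣b*c) = a⊥c (i∣a , coprime-divisor (coprime-∣ a⊥b i∣a ℕ.∣-refl) i∣b*c)

  coprime-∏ : ∀ {k a} (f : Fin k → ℕ) → (∀ i → Coprime a (f i)) → Coprime a (∏ℕ f)
  coprime-∏ {zero}  f _ (_ , i∣1) = ℕ.∣1⇒≡1 i∣1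
  coprime-∏ {suc k} f a⊥f = coprime-*ʳ (a⊥f zero) (coprime-∏ (λ i → f (suc i)) (λ i → a⊥f (suc i)))

  ∏-nonZero : ∀ {k} (f : Fin k → ℕ) → (∀ i → NonZero (f i)) → NonZero (∏ℕ f)
  ∏-nonZero {zero}  f _     = _
  ∏-nonZero {suc k} f f≢0 = ℕ.m*n≢0 (f zero) _ {{f≢0 zero}} {{∏-nonZero (λ i → f (suc i)) (λ i → f≢0 (suc i))}}

  ∏-mono-∣ : ∀ {k} (f g : Fin k → ℕ) → (∀ i → f i ℕ.∣ g i) → ∏ℕ f ℕ.∣ ∏ℕ g
  ∏-mono-∣ {zero}  f g _   = ℕ.∣-refl
  ∏-mono-∣ {suc k} f g f∣g =
    ℕ.*-pres-∣ (f∣g zero) (∏-mono-∣ (λ i → f (suc i)) (λ i → g (suc i)) (λ i → f∣g (suc i)))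

  coprime⇒*∣ : ∀ {m n z} → Coprime m n → m ℕ.∣ z → n ℕ.∣ z → m ℕ.* n ℕ.∣ z
  coprime⇒*∣ {m} {n} m⊥n (ℕ.divides q refl) n∣q*m =
    subst (m ℕ.* n ℕ.∣_) (ℕ.*-comm m q)
      (ℕ.*-monoʳ-∣ m (coprime-divisor (Coprimality.sym m⊥n) (subst (n ℕ.∣_) (ℕ.*-comm q m) n∣q*m)))

  congruent-coprime-* : ∀ {e e′ a b} → Coprime e e′ → Congruent e a b → Congruent e′ a b → Congruent (e ℕ.* e′) a b
  congruent-coprime-* e⊥e′ (congruent p) (congruent p′) = congruent (coprime⇒*∣ e⊥e′ p p′)

  chinese-remainder : ∀ {e e′} → Coprime e e′ → ∀ r r′ →
    Σ ℤ λ R → ∀ x → (Congruent e x r × Congruent e′ x r′) ⇔ Congruent (e ℕ.* e′) x R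
  chinese-remainder {e} {e′} e⊥e′ r r′ = R , λ x → mk⇔
    (λ (x≡r , x≡r′) → congruent-coprime-* e⊥e′ (congruent-trans x≡r r≡R) (congruent-trans x≡r′ r′≡R))
    (λ x≡R → congruent-trans (congruent-∣ (ℕ.m∣m*n e′) x≡R) (congruent-sym r≡R)
           , congruent-trans (congruent-∣ (ℕ.n∣m*n e) x≡R) (congruent-sym r′≡R))
    where
    s = proj₁ (bézout (+ e) e′)
    t = proj₁ (proj₂ (bézout (+ e) e′))
    s*e+t*e′≡1 : s * + e + t * + e′ ≡ 1ℤ
    s*e+t*e′≡1 = trans (proj₂ (proj₂ (bézout (+ e) e′))) (cong +_ (coprime⇒gcd≡1 e⊥e′))
    R = r * (t * + e′) + r′ * (s * + e)
    via-one : ∀ y → y ≡ y * (s * + e + t * + e′)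
    via-one y = sym (trans (cong (y *_) s*e+t*e′≡1) (ℤ.*-identityʳ y))
    r≡R : Congruent e r R
    r≡R = congruent-multiple ((r - r′) * s) (trans (cong (_- R) (via-one r)) (expand r r′ s t (+ e) (+ e′)))
      where expand : ∀ r r′ s t e e′ → r * (s * e + t * e′) - (r * (t * e′) + r′ * (s * e)) ≡ (r - r′) * s * e
            expand = solve-∀
    r′≡R : Congruent e′ r′ R
    r′≡R = congruent-multiple ((r′ - r) * t) (trans (cong (_- R) (via-one r′)) (expand r r′ s t (+ e) (+ e′)))
      where expand : ∀ r r′ s t e e′ → r′ * (s * e + t * e′) - (r * (t * e′) + r′ * (s * e)) ≡ (r′ - r) * t * e′
            expand = solve-∀

  PairwiseCoprime : ∀ {k} → (Fin k → ℕ) → Set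
  PairwiseCoprime d = ∀ i j → i ≢ j → Coprime (d i) (d j)

  pairwiseCoprime-∣ : ∀ {k} {d d′ : Fin k → ℕ} → (∀ i → d′ i ℕ.∣ d i) →
    PairwiseCoprime d → PairwiseCoprime d′
  pairwiseCoprime-∣ d′∣d coprime i j i≢j = coprime-∣ (coprime i j i≢j) (d′∣d i) (d′∣d j)

  pairwiseCoprime-tail : ∀ {k} {d : Fin (suc k) → ℕ} → PairwiseCoprime d → PairwiseCoprime (λ i → d (suc i))
  pairwiseCoprime-tail coprime i j i≢j = coprime (suc i) (suc j) (i≢j ∘ Fin.suc-injective)

  pairwiseCoprime-head : ∀ {k} {d : Fin (suc k) → ℕ} → PairwiseCoprime d → Coprime (d zero) (∏ℕ (λ i → d (suc i)))
  pairwiseCoprime-head coprime = coprime-∏ _ (λ i → coprime zero (suc i) λ ())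

  linear-system : ∀ {k} (d : Fin k → ℕ) (α β : Fin k → ℤ) → (∀ i → NonZero (d i)) → PairwiseCoprime d →
    (∀ i → + (gcd ∣ α i ∣ (d i)) ∣ β i) →
    ResidueClass (λ x → ∀ i → Congruent (d i) (β i) (α i * x)) (∏ℕ d) (∏ℕ (λ i → gcd ∣ α i ∣ (d i)))
  linear-system {zero} d α β _ _ _ = record
    { modulus = 1 ; residue = 0ℤ ; modulus*G≡D = refl ; solutions = λ x → mk⇔ (λ _ → congruent (ℕ.1∣ _)) (λ _ ()) }
  linear-system {suc k} d α β d≢0 coprime g∣β = record
    { modulus     = e ℕ.* E′
    ; residue     = R
    ; modulus*G≡D = trans (ℕ*.interchange e E′ _ _) (cong₂ ℕ._*_ e*g≡d E′*G′≡D′)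
    ; solutions   = λ x → begin
        (∀ i → Congruent (d i) (β i) (α i * x))   ≈⟨ Fin.∀-cons-⇔ ⟨
        (Congruent (d zero) (β zero) (α zero * x) × (∀ i → Congruent (d (suc i)) (β (suc i)) (α (suc i) * x)))
                                                  ≈⟨ solves-head x ×-⇔ solves-tail x ⟩
        (Congruent e x r × Congruent E′ x R′)     ≈⟨ crt x ⟩
        Congruent (e ℕ.* E′) x R                  ∎
    }
    where
    open ⇔-Reasoning
    open ResidueClass (linear-congruence (d zero) {{d≢0 zero}} (α zero) (β zero) (g∣β zero))
      renaming (modulus to e; residue to r; modulus*G≡D to e*g≡d; solutions to solves-head)
    open ResidueClass (linear-system (λ i → d (suc i)) (λ i → α (suc i)) (λ i → β (suc i)) (λ i → d≢0 (suc i))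
                                     (pairwiseCoprime-tail coprime) (λ i → g∣β (suc i)))
      renaming (modulus to E′; residue to R′; modulus*G≡D to E′*G′≡D′; solutions to solves-tail)
    e⊥E′ : Coprime e E′
    e⊥E′ = coprime-∣ (pairwiseCoprime-head coprime) (ℕ.divides g (trans (sym e*g≡d) (ℕ.*-comm e g)))
                                                    (ℕ.divides G′ (trans (sym E′*G′≡D′) (ℕ.*-comm E′ G′)))
      where g  = gcd ∣ α zero ∣ (d zero)
            G′ = ∏ℕ (λ i → gcd ∣ α (suc i) ∣ (d (suc i)))
    R = proj₁ (chinese-remainder e⊥E′ r R′)
    crt = proj₂ (chinese-remainder e⊥E′ r R′)

  -- Counting

  indicator : ∀ {p} {P : Set p} → Dec P → ℕ
  indicator (yes _) = 1
  indicator (no _)  = 0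

  indicator-cong : ∀ {p q} {P : Set p} {Q : Set q} (P? : Dec P) (Q? : Dec Q) → P ⇔ Q → indicator P? ≡ indicator Q?
  indicator-cong (yes _) (yes _) _   = refl
  indicator-cong (yes p) (no ¬q) P⇔Q = contradiction (Equivalence.to P⇔Q p) ¬q
  indicator-cong (no ¬p) (yes q) P⇔Q = contradiction (Equivalence.from P⇔Q q) ¬p
  indicator-cong (no _)  (no _)  _   = refl

  sumBelow : ℕ → (ℕ → ℕ) → ℕ
  sumBelow zero    f = 0
  sumBelow (suc N) f = f 0 ℕ.+ sumBelow N (f ∘ suc)

  sumBelow-cong : ∀ N {f g : ℕ → ℕ} → (∀ x → f x ≡ g x) → sumBelow N f ≡ sumBelow N g
  sumBelow-cong zero    f≗g = refl
  sumBelow-cong (suc N) f≗g = cong₂ ℕ._+_ (f≗g 0) (sumBelow-cong N (f≗g ∘ suc))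

  sumBelow-*ʳ : ∀ N (f : ℕ → ℕ) c → sumBelow N (λ x → f x ℕ.* c) ≡ sumBelow N f ℕ.* c
  sumBelow-*ʳ zero    f c = refl
  sumBelow-*ʳ (suc N) f c = trans (cong (f 0 ℕ.* c ℕ.+_) (sumBelow-*ʳ N (f ∘ suc) c)) (sym (ℕ.*-distribʳ-+ c (f 0) _))

  sumBelow-+ : ∀ M N (f : ℕ → ℕ) → sumBelow (M ℕ.+ N) f ≡ sumBelow M f ℕ.+ sumBelow N (λ x → f (M ℕ.+ x))
  sumBelow-+ zero    N f = refl
  sumBelow-+ (suc M) N f = trans (cong (f 0 ℕ.+_) (sumBelow-+ M N (f ∘ suc))) (sym (ℕ.+-assoc (f 0) _ _))

  count : ∀ {p} {P : Pred ℕ p} → Decidable P → ℕ → ℕ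
  count P? N = sumBelow N (λ x → indicator (P? x))

  count-cong : ∀ {p q} {P : Pred ℕ p} {Q : Pred ℕ q} (P? : Decidable P) (Q? : Decidable Q) →
    (∀ x → P x ⇔ Q x) → ∀ N → count P? N ≡ count Q? N
  count-cong P? Q? P⇔Q N = sumBelow-cong N (λ x → indicator-cong (P? x) (Q? x) (P⇔Q x))

  count-periodic : ∀ {p} {P : Pred ℕ p} (P? : Decidable P) E → (∀ x → P (E ℕ.+ x) ⇔ P x) →
    ∀ q → count P? (q ℕ.* E) ≡ q ℕ.* count P? E
  count-periodic P? E periodic zero    = refl
  count-periodic P? E periodic (suc q) = begin
    count P? (E ℕ.+ q ℕ.* E)
      ≡⟨ sumBelow-+ E (q ℕ.* E) _ ⟩
    count P? E ℕ.+ sumBelow (q ℕ.* E) (λ x → indicator (P? (E ℕ.+ x)))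
      ≡⟨ cong (count P? E ℕ.+_) shift ⟩
    count P? E ℕ.+ count P? (q ℕ.* E)
      ≡⟨ cong (count P? E ℕ.+_) (count-periodic P? E periodic q) ⟩
    count P? E ℕ.+ q ℕ.* count P? E
      ∎
    where open ≡-Reasoning
          shift = sumBelow-cong (q ℕ.* E) (λ x → indicator-cong (P? (E ℕ.+ x)) (P? x) (periodic x))

  count-none : ∀ {p} {P : Pred ℕ p} (P? : Decidable P) N → (∀ x → x ℕ.< N → ¬ P x) → count P? N ≡ 0
  count-none P? zero    _    = refl
  count-none P? (suc N) none with P? 0
  ... | yes P0 = contradiction P0 (none 0 ℕ.z<s)
  ... | no  _  = count-none (P? ∘ suc) N (λ x x<N → none (suc x) (ℕ.s<s x<N))

  count-unique : ∀ {p} {P : Pred ℕ p} (P? : Decidable P) N r → r ℕ.< N → P r →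
    (∀ x → x ℕ.< N → P x → x ≡ r) → count P? N ≡ 1
  count-unique P? (suc N) zero    _           P0 unique with P? 0
  ... | yes _   = cong suc (count-none (P? ∘ suc) N (λ x x<N Px → ℕ.1+n≢0 (unique (suc x) (ℕ.s<s x<N) Px)))
  ... | no  ¬P0 = contradiction P0 ¬P0
  count-unique P? (suc N) (suc r) (ℕ.s<s r<N) Pr unique with P? 0
  ... | yes P0 = contradiction (unique 0 ℕ.z<s P0) ℕ.0≢1+n
  ... | no  _  = count-unique (P? ∘ suc) N r r<N Pr (λ x x<N Px → ℕ.suc-injective (unique (suc x) (ℕ.s<s x<N) Px))

  count-residue : ∀ E .{{_ : NonZero E}} R q → count (λ x → congruent? E (+ x) R) (q ℕ.* E) ≡ q
  count-residue E R q = begin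
    count class? (q ℕ.* E)   ≡⟨ count-periodic class? E periodic q ⟩
    q ℕ.* count class? E     ≡⟨ cong (q ℕ.*_) (count-unique class? E r (n%ℕd<d R E) r≡R unique) ⟩
    q ℕ.* 1              ≡⟨ ℕ.*-identityʳ q ⟩
    q                    ∎
    where
    open ≡-Reasoning
    class? = λ x → congruent? E (+ x) R
    periodic : ∀ x → Congruent E (+ (E ℕ.+ x)) R ⇔ Congruent E (+ x) R
    periodic x = mk⇔ (congruent-trans (congruent-sym E+x≡x)) (congruent-trans E+x≡x)
      where E+x≡x : Congruent E (+ (E ℕ.+ x)) (+ x)
            E+x≡x = congruent-multiple 1ℤ (trans (cong (_- + x) (ℤ.pos-+ E x)) (cancel (+ E) (+ x)))
              where cancel : ∀ e x → e + x - x ≡ 1ℤ * e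
                    cancel = solve-∀
    r = R %ℕ E
    r≡R : Congruent E (+ r) R
    r≡R = congruent-multiple (- (R /ℕ E)) (trans (cong (_-_ (+ r)) (a≡a%ℕn+[a/ℕn]*n R E)) (cancel (+ r) (R /ℕ E) (+ E)))
      where cancel : ∀ r q e → r - (r + q * e) ≡ - q * e
            cancel = solve-∀
    unique : ∀ x → x ℕ.< E → Congruent E (+ x) R → x ≡ r
    unique x x<E x≡R = congruent-<⇒≡ x<E (n%ℕd<d R E) (congruent-trans x≡R (congruent-sym r≡R))

  count-linear-system : ∀ {k} (d : Fin k → ℕ) (α β : Fin k → ℤ) → (∀ i → NonZero (d i)) → PairwiseCoprime d →
    (∀ i → + (gcd ∣ α i ∣ (d i)) ∣ β i) → ∀ M → ∏ℕ d ℕ.∣ M →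
    count (λ x → Fin.all? (λ i → congruent? (d i) (β i) (α i * + x))) M ℕ.* ∏ℕ d
      ≡ M ℕ.* ∏ℕ (λ i → gcd ∣ α i ∣ (d i))
  count-linear-system d α β d≢0 coprime g∣β .(q ℕ.* ∏ℕ d) (ℕ.divides-refl q) = begin
    count system? (q ℕ.* D) ℕ.* D
      ≡⟨ cong (λ N → count system? N ℕ.* D) q*D≡q*G*E ⟩
    count system? (q ℕ.* G ℕ.* E) ℕ.* D
      ≡⟨ cong (ℕ._* D) (count-cong system? class? (solutions ∘ +_) (q ℕ.* G ℕ.* E)) ⟩
    count class? (q ℕ.* G ℕ.* E) ℕ.* D
      ≡⟨ cong (ℕ._* D) (count-residue E R (q ℕ.* G)) ⟩
    q ℕ.* G ℕ.* D
      ≡⟨ ℕ*.xy∙z≈xz∙y q G D ⟩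
    q ℕ.* D ℕ.* G
      ∎
    where
    open ≡-Reasoning
    open ResidueClass (linear-system d α β d≢0 coprime g∣β)
      renaming (modulus to E; residue to R; modulus*G≡D to E*G≡D)
    D = ∏ℕ d
    G = ∏ℕ (λ i → gcd ∣ α i ∣ (d i))
    system? = λ x → Fin.all? (λ i → congruent? (d i) (β i) (α i * + x))
    class? = λ x → congruent? E (+ x) R
    instance
      E≢0 : NonZero E
      E≢0 = ℕ.m*n≢0⇒m≢0 E {{subst NonZero (sym E*G≡D) (∏-nonZero d d≢0)}}
    q*D≡q*G*E : q ℕ.* D ≡ q ℕ.* G ℕ.* E
    q*D≡q*G*E = trans (cong (q ℕ.*_) (sym E*G≡D)) (ℕ*.x∙yz≈xz∙y q E G)

  sum-tabulate : ∀ N {h : Fin N → ℕ} (G : ℕ → ℕ) → (∀ c → h c ≡ G (toℕ c)) → sum (tabulate h) ≡ sumBelow N G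
  sum-tabulate zero    G _   = refl
  sum-tabulate (suc N) G h≗G = cong₂ ℕ._+_ (h≗G zero) (sum-tabulate N (G ∘ suc) (h≗G ∘ suc))

  length-filter-map : ∀ {a b p q} {A : Set a} {B : Set b} {P : Pred A p} {Q : Pred B q}
    (P? : Decidable P) (Q? : Decidable Q) (g : B → A) → (∀ y → P (g y) ⇔ Q y) →
    ∀ ys → length (filter P? (map g ys)) ≡ length (filter Q? ys)
  length-filter-map P? Q? g P∘g⇔Q []       = refl
  length-filter-map P? Q? g P∘g⇔Q (y ∷ ys) with P? (g y) | Q? y
  ... | yes _  | yes _  = cong suc (length-filter-map P? Q? g P∘g⇔Q ys)
  ... | yes p  | no ¬q  = contradiction (Equivalence.to (P∘g⇔Q y) p) ¬q
  ... | no ¬p  | yes q  = contradiction (Equivalence.from (P∘g⇔Q y) q) ¬p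
  ... | no _   | no _   = length-filter-map P? Q? g P∘g⇔Q ys

  length-filter-concatMap : ∀ {a b p} {A : Set a} {B : Set b} {P : Pred B p} (P? : Decidable P) (f : A → List B) xs →
    length (filter P? (concatMap f xs)) ≡ sum (map (λ x → length (filter P? (f x))) xs)
  length-filter-concatMap P? f []       = refl
  length-filter-concatMap P? f (x ∷ xs) = begin
    length (filter P? (f x ++ concatMap f xs))
      ≡⟨ cong length (List.filter-++ P? (f x) (concatMap f xs)) ⟩
    length (filter P? (f x) ++ filter P? (concatMap f xs))
      ≡⟨ List.length-++ (filter P? (f x)) ⟩
    length (filter P? (f x)) ℕ.+ length (filter P? (concatMap f xs))
      ≡⟨ cong (length (filter P? (f x)) ℕ.+_) (length-filter-concatMap P? f xs) ⟩
    length (filter P? (f x)) ℕ.+ sum (map (λ x → length (filter P? (f x))) xs)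
      ∎
    where open ≡-Reasoning

  filter-witness : ∀ {a p} {A : Set a} {P : Pred A p} (P? : Decidable P) xs → length (filter P? xs) ≢ 0 → Σ A P
  filter-witness P? []       nonempty = contradiction refl nonempty
  filter-witness P? (x ∷ xs) nonempty with P? x
  ... | yes Px = x , Px
  ... | no  _  = filter-witness P? xs nonempty

  -- Systems in n unknowns

  gcdWith-∣ : ∀ {n} (u : Fin n → ℤ) m → gcdWith u m ℕ.∣ m
  gcdWith-∣ {zero}  u m = ℕ.∣-refl
  gcdWith-∣ {suc n} u m = ℕ.∣-trans (gcd[m,n]∣n ∣ u zero ∣ _) (gcdWith-∣ (λ j → u (suc j)) m)

  gcdWith-∣-∑ : ∀ {n} (u : Fin n → ℤ) m (x : Fin n → ℤ) → + gcdWith u m ∣ ∑ℤ (λ j → u j * x j)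
  gcdWith-∣-∑ {zero}  u m x = ℕ._∣0 (gcdWith u m)
  gcdWith-∣-∑ {suc n} u m x = Signed.∣⇒∣ᵤ (Signed.∣m∣n⇒∣m+n ∣head ∣tail)
    where
    g = gcdWith u m
    ∑tail = ∑ℤ (λ j → u (suc j) * x (suc j))
    ∣head : + g Signed.∣ u zero * x zero
    ∣head = Signed.∣m⇒∣m*n (x zero) (Signed.∣ᵤ⇒∣ {+ g} {u zero} (gcd[m,n]∣m ∣ u zero ∣ _))
    ∣tail : + g Signed.∣ ∑tail
    ∣tail = Signed.∣ᵤ⇒∣ {+ g} {∑tail}
      (ℕ.∣-trans (gcd[m,n]∣n ∣ u zero ∣ _) (gcdWith-∣-∑ (λ j → u (suc j)) m (λ j → x (suc j))))

  gcdWith-nonZero : ∀ {n} (u : Fin n → ℤ) m → .{{NonZero m}} → NonZero (gcdWith u m)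
  gcdWith-nonZero {zero}  u (suc _) = _
  gcdWith-nonZero {suc n} u m = ℕ.≢-nonZero λ g≡0 →
    ℕ.≢-nonZero⁻¹ _ {{gcdWith-nonZero (λ j → u (suc j)) m}} (gcd[m,n]≡0⇒n≡0 ∣ u zero ∣ g≡0)

  GcdCondition : ∀ {k n} → (Fin k → Fin n → ℤ) → (Fin k → ℤ) → (Fin k → ℕ) → Set
  GcdCondition a b ms = ∀ i → + gcdWith (a i) (ms i) ∣ b i

  solution⇒gcdCondition : ∀ {k n m} (a : Fin k → Fin n → ℤ) b ms (x : Vec (Fin m) n) →
    Solves a b ms x → GcdCondition a b ms
  solution⇒gcdCondition a b ms x solves i = Signed.∣⇒∣ᵤ (subst (Signed._∣_ (+ ℓ)) (S-[S-b]≡b S (b i))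
    (Signed.∣m∣n⇒∣m-n (Signed.∣ᵤ⇒∣ {+ ℓ} {S} (gcdWith-∣-∑ (a i) (ms i) (λ j → ⟦ lookup x j ⟧)))
                      (Signed.∣ᵤ⇒∣ {+ ℓ} {S - b i} (ℕ.∣-trans (gcdWith-∣ (a i) (ms i)) (solves i)))))
    where
    ℓ = gcdWith (a i) (ms i)
    S = ∑ℤ (λ j → a i j * ⟦ lookup x j ⟧)
    S-[S-b]≡b : ∀ S b → S - (S - b) ≡ b
    S-[S-b]≡b = solve-∀

  solves-∷ : ∀ {k n m} (a : Fin k → Fin (suc n) → ℤ) b ms (c : Fin m) (v : Vec (Fin m) n) →
    Solves a b ms (c ∷ v) ⇔ Solves (λ i j → a i (suc j)) (λ i → b i - a i zero * ⟦ c ⟧) ms v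
  solves-∷ a b ms c v = mk⇔ (λ s i → subst (+ ms i ∣_) (reassociate i) (s i))
                            (λ s i → subst (+ ms i ∣_) (sym (reassociate i)) (s i))
    where
    reassociate : ∀ i → (a i zero * ⟦ c ⟧ + ∑ℤ (λ j → a i (suc j) * ⟦ lookup v j ⟧)) - b i
                        ≡ ∑ℤ (λ j → a i (suc j) * ⟦ lookup v j ⟧) - (b i - a i zero * ⟦ c ⟧)
    reassociate i = shuffle (a i zero * ⟦ c ⟧) (∑ℤ (λ j → a i (suc j) * ⟦ lookup v j ⟧)) (b i)
      where shuffle : ∀ t S b → (t + S) - b ≡ S - (b - t)
            shuffle = solve-∀

  #solutions-suc : ∀ {k} n m (a : Fin k → Fin (suc n) → ℤ) b ms →
    #solutions (suc n) m a b ms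
      ≡ sumBelow m (λ x → #solutions n m (λ i j → a i (suc j)) (λ i → b i - a i zero * + x) ms)
  #solutions-suc n m a b ms = begin
    length (filter (solves? a b ms) (concatMap extend (allFin m)))
      ≡⟨ length-filter-concatMap (solves? a b ms) extend (allFin m) ⟩
    sum (map #extend (allFin m))
      ≡⟨ cong sum (List.map-tabulate id #extend) ⟩
    sum (tabulate #extend)
      ≡⟨ sum-tabulate m _ (λ c → length-filter-map (solves? a b ms) (solves? _ _ ms) (c ∷_) (solves-∷ a b ms c) vs) ⟩
    sumBelow m (λ x → #solutions n m (λ i j → a i (suc j)) (λ i → b i - a i zero * + x) ms)
      ∎
    where
    open ≡-Reasoning
    vs = allVecs n m
    extend = λ c → map (c ∷_) vs
    #extend = λ c → length (filter (solves? a b ms) (extend c))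

  #solutions≡0 : ∀ {k} n m (a : Fin k → Fin n → ℤ) b ms → ¬ GcdCondition a b ms → #solutions n m a b ms ≡ 0
  #solutions≡0 n m a b ms ¬cond = cong length (List.filter-none (solves? a b ms)
    (All.universal (λ x s → ¬cond (solution⇒gcdCondition a b ms x s)) (allVecs n m)))

  -- Counting `#solutions * m` rather than `#solutions` keeps the case n = 0 inside the induction.
  #solutions*m : ∀ {k} n (a : Fin k → Fin n → ℤ) b ms → (∀ i → NonZero (ms i)) → PairwiseCoprime ms →
    GcdCondition a b ms →
    #solutions n (∏ℕ ms) a b ms ℕ.* ∏ℕ ms ≡ ∏ℕ ms ^ n ℕ.* ∏ℕ (λ i → gcdWith (a i) (ms i))
  #solutions*m zero a b ms _ _ cond =
    cong (λ xs → length xs ℕ.* ∏ℕ ms) (List.filter-accept (solves? {m = ∏ℕ ms} a b ms) {xs = []} solves-[])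
    where solves-[] : Solves {m = ∏ℕ ms} a b ms []
          solves-[] i = subst (ms i ℕ.∣_) (sym (trans (cong ∣_∣ (ℤ.+-identityˡ (- b i))) (ℤ.∣-i∣≡∣i∣ (b i))))
                              (cond i)
  #solutions*m (suc n) a b ms ms≢0 coprime cond = begin
    #solutions (suc n) m a b ms ℕ.* m                   ≡⟨ cong (ℕ._* m) (#solutions-suc n m a b ms) ⟩
    sumBelow m #fibre ℕ.* m                             ≡⟨ sumBelow-*ʳ m #fibre m ⟨
    sumBelow m (λ x → #fibre x ℕ.* m)                   ≡⟨ sumBelow-cong m #fibre*m ⟩
    sumBelow m (λ x → indicator (admissible? x) ℕ.* W)  ≡⟨ sumBelow-*ʳ m (λ x → indicator (admissible? x)) W ⟩
    count admissible? m ℕ.* (m ^ n ℕ.* ∏ℕ ℓ′)           ≡⟨ ℕ*.x∙yz≈y∙xz (count admissible? m) (m ^ n) (∏ℕ ℓ′) ⟩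
    m ^ n ℕ.* (count admissible? m ℕ.* ∏ℕ ℓ′)           ≡⟨ cong (m ^ n ℕ.*_) #admissible*∏ℓ′ ⟩
    m ^ n ℕ.* (m ℕ.* ∏ℕ ℓ)                              ≡⟨ ℕ*.x∙yz≈yx∙z (m ^ n) m (∏ℕ ℓ) ⟩
    m ^ suc n ℕ.* ∏ℕ ℓ                                  ∎
    where
    open ≡-Reasoning
    m = ∏ℕ ms
    a′ : Fin _ → Fin n → ℤ
    a′ i j = a i (suc j)
    b′ : ℕ → Fin _ → ℤ
    b′ x i = b i - a i zero * + x
    ℓ  = λ i → gcdWith (a i) (ms i)
    ℓ′ = λ i → gcdWith (a′ i) (ms i)
    #fibre = λ x → #solutions n m a′ (b′ x) ms
    admissible? = λ x → Fin.all? (λ i → congruent? (ℓ′ i) (b i) (a i zero * + x))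
    W = m ^ n ℕ.* ∏ℕ ℓ′
    #fibre*m : ∀ x → #fibre x ℕ.* m ≡ indicator (admissible? x) ℕ.* W
    #fibre*m x with admissible? x
    ... | yes s  = trans (#solutions*m n a′ (b′ x) ms ms≢0 coprime (holds ∘ s)) (sym (ℕ.+-identityʳ W))
    ... | no  ¬s = cong (ℕ._* m) (#solutions≡0 n m a′ (b′ x) ms (¬s ∘ (congruent ∘_)))
    ℓ′∣ms : ∀ i → ℓ′ i ℕ.∣ ms i
    ℓ′∣ms i = gcdWith-∣ (a′ i) (ms i)
    #admissible*∏ℓ′ : count admissible? m ℕ.* ∏ℕ ℓ′ ≡ m ℕ.* ∏ℕ ℓ
    #admissible*∏ℓ′ = count-linear-system ℓ′ (λ i → a i zero) b (λ i → gcdWith-nonZero (a′ i) (ms i) {{ms≢0 i}})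
      (pairwiseCoprime-∣ ℓ′∣ms coprime) cond m (∏-mono-∣ ℓ′ ms ℓ′∣ms)

open LinearCongruences
open import Data.Nat using (_*_)

theorem2 : (k n : ℕ) → k ≥ 1 → n ≥ 1
  → (a : Fin k → Fin n → ℤ) (b : Fin k → ℤ) (ms : Fin k → ℕ)
  → ((i : Fin k) → ms i > 0)
  → ((i j : Fin k) → i ≢ j → Coprime (ms i) (ms j))
  → let m = ∏ℕ ms
        ℓ = λ (i : Fin k) → gcdWith (a i) (ms i)
    in (Σ (Vec (Fin m) n) (Solves a b ms) ⇔ ((i : Fin k) → (+ ℓ i) ∣ b i))
       × (((i : Fin k) → (+ ℓ i) ∣ b i)
          → #solutions n m a b ms ≡ m ^ (n ∸ 1) * ∏ℕ ℓ)
theorem2 k (suc n) _ _ a b ms ms>0 coprime =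
  mk⇔ (λ (x , solves) → solution⇒gcdCondition a b ms x solves) solvable , #solutions≡
  where
  m = ∏ℕ ms
  ℓ = λ i → gcdWith (a i) (ms i)
  ms≢0 : ∀ i → NonZero (ms i)
  ms≢0 i = ℕ.>-nonZero (ms>0 i)
  instance
    m≢0 : NonZero m
    m≢0 = ∏-nonZero ms ms≢0
    m^n*∏ℓ≢0 : NonZero (m ^ n * ∏ℕ ℓ)
    m^n*∏ℓ≢0 = ℕ.m*n≢0 (m ^ n) (∏ℕ ℓ) {{ℕ.m^n≢0 m n}}
                       {{∏-nonZero ℓ (λ i → gcdWith-nonZero (a i) (ms i) {{ms≢0 i}})}}
  #solutions≡ : GcdCondition a b ms → #solutions (suc n) m a b ms ≡ m ^ n * ∏ℕ ℓ
  #solutions≡ cond = ℕ.*-cancelʳ-≡ _ _ m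
    (trans (#solutions*m (suc n) a b ms ms≢0 coprime cond) (ℕ*.xy∙z≈yz∙x m (m ^ n) (∏ℕ ℓ)))
  solvable : GcdCondition a b ms → Σ (Vec (Fin m) (suc n)) (Solves a b ms)
  solvable cond = filter-witness (solves? a b ms) (allVecs (suc n) m)
    (λ #≡0 → ℕ.≢-nonZero⁻¹ (m ^ n * ∏ℕ ℓ) (trans (sym (#solutions≡ cond)) #≡0))
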